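{- Let $n\ge 2$ and let $R$ be the $n\times n$ matrix with $(i,j)$ entry $\binom{i-1}{n-j}$, $1\le i,j\le n$. For an integer $e\ge 2$ let $a^{(e)}_{i,j}$ denote the $(i,j)$ entry of $R^e$. Then for all $1\le i\le n-1$ and $1\le j\le n$, \[ F_{e-1}\,a^{(e)}_{i+1,j}=F_e\,a^{(e)}_{i,j}-\sum_{k=1}^{j-1}(-1)^{k+e}\frac{F_e^{\,k-1}}{F_{e-1}^{\,k}}\,a^{(e)}_{i,j-k}. \]
   Context: Convention: $\binom{m}{k}=0$ if $k<0$ or $k>m$; an empty sum is $0$. The Fibonacci sequence is $F_0=0$, $F_1=1$, $F_{m+1}=F_m+F_{m-1}$. -}

module Defs where

open import Data.Nat using (ℕ; zero; suc; _+_; _*_; _∸_; _≤_; s≤s; z≤n; NonZero)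
open import Data.Nat.Combinatorics using (_C_)
open import Data.Rational using (ℚ; 0ℚ) renaming (_+_ to _+ℚ_)

fib : ℕ → ℕ
fib zero = zero
fib (suc zero) = suc zero
fib (suc (suc m)) = fib (suc m) + fib m

fib-suc-nonzero : ∀ m → NonZero (fib (suc m))
fib-suc-nonzero zero = _
fib-suc-nonzero (suc m) with fib (suc m) | fib-suc-nonzero m
... | suc x | _ = _

fib-pred-nonzero : ∀ e → 2 ≤ e → NonZero (fib (e ∸ 1))
fib-pred-nonzero (suc (suc m)) (s≤s (s≤s z≤n)) = fib-suc-nonzero m

-- Matrices of size n are represented as functions ℕ → ℕ → ℕ, with
-- 1-based indices; only entries (i,j) with 1 ≤ i,j ≤ n are meaningful.
Mat : Set
Mat = ℕ → ℕ → ℕ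

sumFrom1 : ℕ → (ℕ → ℕ) → ℕ
sumFrom1 zero f = zero
sumFrom1 (suc m) f = sumFrom1 m f + f (suc m)

sumℚFrom1 : ℕ → (ℕ → ℚ) → ℚ
sumℚFrom1 zero f = 0ℚ
sumℚFrom1 (suc m) f = sumℚFrom1 m f +ℚ f (suc m)

mul : ℕ → Mat → Mat → Mat
mul n A B i j = sumFrom1 n (λ k → A i k * B k j)

idMat : Mat
idMat zero zero = 1
idMat zero (suc j) = 0
idMat (suc i) zero = 0
idMat (suc i) (suc j) = idMat i j

pow : ℕ → Mat → ℕ → Mat
pow n A zero = idMat
pow n A (suc e) = mul n (pow n A e) A

-- R with (i,j) entry binom(i-1, n-j)  (1 ≤ i,j ≤ n); stdlib's C is 0 when k > m
Rmat : ℕ → Mat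
Rmat n i j = (i ∸ 1) C (n ∸ j)

a : ℕ → ℕ → ℕ → ℕ → ℕ
a n e i j = pow n (Rmat n) e i j

module Submission where

-- Call rows z, x of length n linked with coefficients (β, α; δ, γ) when
-- β z_k + α z_{k-1} = δ x_k + γ x_{k-1} for 1 ≤ k ≤ n + 1.  As R has entries
-- C(k-1, n-j), Pascal's rule shows that multiplying linked rows (with vanishing
-- 0-th entries) by R links them with coefficients (α, α + β; γ, γ + δ).
-- Consecutive rows of R^0 = I are linked with (1, 0; 0, 1), hence consecutive
-- rows of R^e with (F_{e-1}, F_e; F_e, F_{e+1}).  Read as a first-order
-- recurrence in j for row i + 1, this is solved by induction on j: the kernel
-- t_k = (-1)^{k+e} F_e^{k-1} / F_{e-1}^k satisfies F_{e-1} t_1 = -(-1)^e and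
-- F_{e-1} t_{k+1} = -F_e t_k, and Cassini's identity
-- F_{e-1} F_{e+1} = F_e^2 + (-1)^e makes the induction step close.

module BinomialRows where
  open import Defs using (fib; sumFrom1; idMat; pow; Rmat)
  open import Data.Nat using (ℕ; zero; suc; _+_; _*_; _∸_; _≤_; _<_; s≤s; z≤n)
  open import Data.Nat.Properties using (m≤n⇒m≤1+n; ≤-refl; +-identityʳ; +-assoc; *-zeroʳ; *-distribˡ-+; n∸n≡0; +-∸-assoc)
  open import Data.Nat.Combinatorics using (_C_; nCk+nC[k+1]≡[n+1]C[k+1])
  open import Data.Nat.Combinatorics.Specification using (k>n⇒nCk≡0)
  open import Data.Nat.Tactic.RingSolver using (solve-∀)
  open import Relation.Binary.PropositionalEquality
  open ≡-Reasoning

  sumFrom1-cong : ∀ m {f g : ℕ → ℕ} → (∀ k → 1 ≤ k → k ≤ m → f k ≡ g k) → sumFrom1 m f ≡ sumFrom1 m g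
  sumFrom1-cong zero f≗g = refl
  sumFrom1-cong (suc m) f≗g =
    cong₂ _+_ (sumFrom1-cong m (λ k 1≤k k≤m → f≗g k 1≤k (m≤n⇒m≤1+n k≤m))) (f≗g (suc m) (s≤s z≤n) ≤-refl)

  sumFrom1-zero : ∀ m (f : ℕ → ℕ) → (∀ k → 1 ≤ k → k ≤ m → f k ≡ 0) → sumFrom1 m f ≡ 0
  sumFrom1-zero zero f f≗0 = refl
  sumFrom1-zero (suc m) f f≗0 =
    cong₂ _+_ (sumFrom1-zero m f (λ k 1≤k k≤m → f≗0 k 1≤k (m≤n⇒m≤1+n k≤m))) (f≗0 (suc m) (s≤s z≤n) ≤-refl)

  sumFrom1-+ : ∀ m (f g : ℕ → ℕ) → sumFrom1 m (λ k → f k + g k) ≡ sumFrom1 m f + sumFrom1 m g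
  sumFrom1-+ zero f g = refl
  sumFrom1-+ (suc m) f g rewrite sumFrom1-+ m f g = interchange (sumFrom1 m f) (sumFrom1 m g) (f (suc m)) (g (suc m))
    where
    interchange : ∀ a b c d → a + b + (c + d) ≡ a + c + (b + d)
    interchange = solve-∀

  sumFrom1-*ˡ : ∀ m c (f : ℕ → ℕ) → sumFrom1 m (λ k → c * f k) ≡ c * sumFrom1 m f
  sumFrom1-*ˡ zero c f = sym (*-zeroʳ c)
  sumFrom1-*ˡ (suc m) c f rewrite sumFrom1-*ˡ m c f = sym (*-distribˡ-+ c (sumFrom1 m f) (f (suc m)))

  sumFrom1-suc : ∀ m (f : ℕ → ℕ) → sumFrom1 (suc m) f ≡ f 1 + sumFrom1 m (λ k → f (suc k))
  sumFrom1-suc zero f = sym (+-identityʳ (f 1))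
  sumFrom1-suc (suc m) f rewrite sumFrom1-suc m f = +-assoc (f 1) _ _

  -- F_{e-1}, with the convention F_{-1} = 1 that lets R^0 = I fit the pattern.
  fibPred : ℕ → ℕ
  fibPred zero = 1
  fibPred (suc e) = fib e

  fib-suc : ∀ e → fib (suc e) ≡ fib e + fibPred e
  fib-suc zero = refl
  fib-suc (suc e) = refl

  module _ (n : ℕ) where

    pascalSum : (ℕ → ℕ) → ℕ → ℕ
    pascalSum z t = sumFrom1 n (λ k → z k * ((k ∸ 1) C t))

    -- Row z times R; `pow n (Rmat n) (suc e) i` is definitionally `pow n (Rmat n) e i ·R`.
    _·R : (ℕ → ℕ) → ℕ → ℕ
    (z ·R) j = pascalSum z (n ∸ j)

    ·R-zeroColumn : ∀ (z : ℕ → ℕ) → (z ·R) 0 ≡ 0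
    ·R-zeroColumn z = sumFrom1-zero n _ λ where
      (suc k) _ k<n → trans (cong (z (suc k) *_) (k>n⇒nCk≡0 {k} {n} k<n)) (*-zeroʳ (z (suc k)))

    pascalSum-shift : ∀ (z : ℕ → ℕ) → z 0 ≡ 0 → ∀ t →
      sumFrom1 (suc n) (λ k → z (k ∸ 1) * ((k ∸ 1) C t)) ≡ sumFrom1 n (λ k → z k * (k C t))
    pascalSum-shift z z0≡0 t =
      trans (sumFrom1-suc n (λ k → z (k ∸ 1) * ((k ∸ 1) C t)))
            (cong (λ w → w * (0 C t) + sumFrom1 n (λ k → z k * (k C t))) z0≡0)

    pascalSum-pascal : ∀ (z : ℕ → ℕ) t → sumFrom1 n (λ k → z k * (k C suc t)) ≡ pascalSum z t + pascalSum z (suc t)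
    pascalSum-pascal z t = trans (sumFrom1-cong n pascal) (sumFrom1-+ n _ _)
      where
      pascal : ∀ k → 1 ≤ k → k ≤ n → z k * (k C suc t) ≡ z k * ((k ∸ 1) C t) + z k * ((k ∸ 1) C suc t)
      pascal (suc k) _ _ = trans (cong (z (suc k) *_) (sym (nCk+nC[k+1]≡[n+1]C[k+1] k t))) (*-distribˡ-+ (z (suc k)) _ _)

    -- The boundary equation is the instance k = n + 1, reading both rows as zero beyond column n.
    record Linked (β α δ γ : ℕ) (z x : ℕ → ℕ) : Set where
      field
        interior : ∀ k → 1 ≤ k → k ≤ n → β * z k + α * z (k ∸ 1) ≡ δ * x k + γ * x (k ∸ 1)
        boundary : α * z n ≡ γ * x n

    linkedSum : ℕ → ℕ → (ℕ → ℕ) → ℕ → ℕ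
    linkedSum β α z t = sumFrom1 n (λ k → (β * z k + α * z (k ∸ 1)) * ((k ∸ 1) C t)) + α * z n * (n C t)

    linkedSum-cong : ∀ {β α δ γ} {z x : ℕ → ℕ} → Linked β α δ γ z x → ∀ t → linkedSum β α z t ≡ linkedSum δ γ x t
    linkedSum-cong z~x t = cong₂ _+_
      (sumFrom1-cong n (λ k 1≤k k≤n → cong (_* ((k ∸ 1) C t)) (Linked.interior z~x k 1≤k k≤n)))
      (cong (_* (n C t)) (Linked.boundary z~x))

    linkedSum-expand : ∀ β α (z : ℕ → ℕ) → z 0 ≡ 0 → ∀ t →
      linkedSum β α z t ≡ β * pascalSum z t + α * sumFrom1 n (λ k → z k * (k C t))
    linkedSum-expand β α z z0≡0 t = begin
      linkedSum β α z t
        ≡⟨ cong (_+ α * z n * (n C t)) (sumFrom1-cong n (λ k _ _ → distrib β α (z k) (z (k ∸ 1)) _)) ⟩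
      sumFrom1 n (λ k → β * (z k * ((k ∸ 1) C t)) + α * (z (k ∸ 1) * ((k ∸ 1) C t))) + α * z n * (n C t)
        ≡⟨ cong (_+ α * z n * (n C t)) (trans (sumFrom1-+ n _ _) (cong₂ _+_ (sumFrom1-*ˡ n β _) (sumFrom1-*ˡ n α _))) ⟩
      β * pascalSum z t + α * sumFrom1 n (λ k → z (k ∸ 1) * ((k ∸ 1) C t)) + α * z n * (n C t)
        ≡⟨ regroup α (β * pascalSum z t) (sumFrom1 n _) (z n) (n C t) ⟩
      β * pascalSum z t + α * sumFrom1 (suc n) (λ k → z (k ∸ 1) * ((k ∸ 1) C t))
        ≡⟨ cong (λ w → β * pascalSum z t + α * w) (pascalSum-shift z z0≡0 t) ⟩
      β * pascalSum z t + α * sumFrom1 n (λ k → z k * (k C t)) ∎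
      where
      distrib : ∀ β α y y′ c → (β * y + α * y′) * c ≡ β * (y * c) + α * (y′ * c)
      distrib = solve-∀
      regroup : ∀ α s s′ w c → s + α * s′ + α * w * c ≡ s + α * (s′ + w * c)
      regroup = solve-∀

    linkedSum-zero : ∀ β α (z : ℕ → ℕ) → z 0 ≡ 0 → linkedSum β α z 0 ≡ (α + β) * pascalSum z 0
    linkedSum-zero β α z z0≡0 = trans (linkedSum-expand β α z z0≡0 0) (swap β α (pascalSum z 0))
      where
      swap : ∀ β α s → β * s + α * s ≡ (α + β) * s
      swap = solve-∀

    linkedSum-suc : ∀ β α (z : ℕ → ℕ) → z 0 ≡ 0 → ∀ t →
      linkedSum β α z (suc t) ≡ α * pascalSum z t + (α + β) * pascalSum z (suc t)
    linkedSum-suc β α z z0≡0 t = begin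
      linkedSum β α z (suc t)
        ≡⟨ linkedSum-expand β α z z0≡0 (suc t) ⟩
      β * pascalSum z (suc t) + α * sumFrom1 n (λ k → z k * (k C suc t))
        ≡⟨ cong (λ w → β * pascalSum z (suc t) + α * w) (pascalSum-pascal z t) ⟩
      β * pascalSum z (suc t) + α * (pascalSum z t + pascalSum z (suc t))
        ≡⟨ regroup β α (pascalSum z t) (pascalSum z (suc t)) ⟩
      α * pascalSum z t + (α + β) * pascalSum z (suc t) ∎
      where
      regroup : ∀ β α s s′ → β * s′ + α * (s + s′) ≡ α * s + (α + β) * s′
      regroup = solve-∀

    Linked-·R : ∀ {β α δ γ} {z x : ℕ → ℕ} → z 0 ≡ 0 → x 0 ≡ 0 → Linked β α δ γ z x →
      Linked α (α + β) γ (γ + δ) (z ·R) (x ·R)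
    Linked-·R {β} {α} {δ} {γ} {z} {x} z0≡0 x0≡0 z~x = record { interior = interior ; boundary = boundary }
      where
      interior : ∀ j → 1 ≤ j → j ≤ n →
        α * (z ·R) j + (α + β) * (z ·R) (j ∸ 1) ≡ γ * (x ·R) j + (γ + δ) * (x ·R) (j ∸ 1)
      interior (suc j) _ j<n rewrite +-∸-assoc 1 j<n = begin
        α * pascalSum z t + (α + β) * pascalSum z (suc t) ≡⟨ linkedSum-suc β α z z0≡0 t ⟨
        linkedSum β α z (suc t)                          ≡⟨ linkedSum-cong z~x (suc t) ⟩
        linkedSum δ γ x (suc t)                          ≡⟨ linkedSum-suc δ γ x x0≡0 t ⟩
        γ * pascalSum x t + (γ + δ) * pascalSum x (suc t) ∎
        where t = n ∸ suc j
      boundary : (α + β) * (z ·R) n ≡ (γ + δ) * (x ·R) n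
      boundary rewrite n∸n≡0 n = begin
        (α + β) * pascalSum z 0 ≡⟨ linkedSum-zero β α z z0≡0 ⟨
        linkedSum β α z 0       ≡⟨ linkedSum-cong z~x 0 ⟩
        linkedSum δ γ x 0       ≡⟨ linkedSum-zero δ γ x x0≡0 ⟩
        (γ + δ) * pascalSum x 0 ∎

    idMat-off : ∀ i j → i < j → idMat i j ≡ 0
    idMat-off zero (suc j) _ = refl
    idMat-off (suc i) (suc j) (s≤s i<j) = idMat-off i j i<j

    idMat-rows-linked : ∀ i → i < n → Linked 1 0 0 1 (idMat (suc i)) (idMat i)
    idMat-rows-linked i i<n = record
      { interior = λ where (suc k) _ _ → +-identityʳ _
      ; boundary = sym (trans (+-identityʳ _) (idMat-off i n i<n)) }

    pow-zeroColumn : ∀ e i → 1 ≤ i → pow n (Rmat n) e i 0 ≡ 0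
    pow-zeroColumn zero (suc i) _ = refl
    pow-zeroColumn (suc e) i _ = ·R-zeroColumn (pow n (Rmat n) e i)

    pow-rows-linked : ∀ e i → 1 ≤ i → i < n →
      Linked (fibPred e) (fib e) (fib e) (fib (suc e)) (pow n (Rmat n) e (suc i)) (pow n (Rmat n) e i)
    pow-rows-linked zero i _ i<n = idMat-rows-linked i i<n
    pow-rows-linked (suc e) i 1≤i i<n =
      subst (λ c → Linked (fib e) c (fib (suc e)) (fib (suc (suc e)))
                                (pow n (Rmat n) (suc e) (suc i)) (pow n (Rmat n) (suc e) i)) (sym (fib-suc e))
        (Linked-·R (pow-zeroColumn e (suc i) (s≤s z≤n)) (pow-zeroColumn e i 1≤i) (pow-rows-linked e i 1≤i i<n))

module RationalCasts where
  open import Data.Nat as ℕ using (suc)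
  open import Data.Integer as ℤ using (ℤ; +_)
  open import Data.Integer.Properties using (pos-+; pos-*)
  open import Data.Integer.Tactic.RingSolver using (solve-∀)
  open import Data.Rational using (ℚ; _/_; _*_; _+_; -_; 1ℚ; toℚᵘ)
  open import Data.Rational.Properties
    using (toℚᵘ-injective; toℚᵘ-homo-+; toℚᵘ-homo-*; toℚᵘ-homo‿-; toℚᵘ-fromℚᵘ; *-identityʳ; *-assoc; *-comm)
  open import Data.Rational.Unnormalised as ℚᵘ using (mkℚᵘ; *≡*)
  import Data.Rational.Unnormalised.Properties as ℚᵘ
  open import Relation.Binary.PropositionalEquality

  ι : ℤ → ℚ
  ι p = p / 1

  toℚᵘ-ι : ∀ p → toℚᵘ (ι p) ℚᵘ.≃ mkℚᵘ p 0
  toℚᵘ-ι p = toℚᵘ-fromℚᵘ (mkℚᵘ p 0)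

  ι-+ : ∀ p q → ι (p ℤ.+ q) ≡ ι p + ι q
  ι-+ p q = toℚᵘ-injective (begin-equality
    toℚᵘ (ι (p ℤ.+ q))          ≃⟨ toℚᵘ-ι (p ℤ.+ q) ⟩
    mkℚᵘ (p ℤ.+ q) 0            ≃⟨ *≡* (cross p q) ⟩
    mkℚᵘ p 0 ℚᵘ.+ mkℚᵘ q 0      ≃⟨ ℚᵘ.+-cong (toℚᵘ-ι p) (toℚᵘ-ι q) ⟨
    toℚᵘ (ι p) ℚᵘ.+ toℚᵘ (ι q)  ≃⟨ toℚᵘ-homo-+ (ι p) (ι q) ⟨
    toℚᵘ (ι p + ι q)            ∎)
    where
    open ℚᵘ.≤-Reasoning
    cross : ∀ p q → (p ℤ.+ q) ℤ.* + 1 ≡ (p ℤ.* + 1 ℤ.+ q ℤ.* + 1) ℤ.* + 1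
    cross = solve-∀

  ι-* : ∀ p q → ι (p ℤ.* q) ≡ ι p * ι q
  ι-* p q = toℚᵘ-injective (begin-equality
    toℚᵘ (ι (p ℤ.* q))          ≃⟨ toℚᵘ-ι (p ℤ.* q) ⟩
    mkℚᵘ (p ℤ.* q) 0            ≃⟨ ℚᵘ.*-cong (toℚᵘ-ι p) (toℚᵘ-ι q) ⟨
    toℚᵘ (ι p) ℚᵘ.* toℚᵘ (ι q)  ≃⟨ toℚᵘ-homo-* (ι p) (ι q) ⟨
    toℚᵘ (ι p * ι q)            ∎)
    where open ℚᵘ.≤-Reasoning

  ι-neg : ∀ p → ι (ℤ.- p) ≡ - ι p
  ι-neg p = toℚᵘ-injective (begin-equality
    toℚᵘ (ι (ℤ.- p))   ≃⟨ toℚᵘ-ι (ℤ.- p) ⟩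
    mkℚᵘ (ℤ.- p) 0     ≃⟨ ℚᵘ.-‿cong (toℚᵘ-ι p) ⟨
    ℚᵘ.- toℚᵘ (ι p)    ≃⟨ toℚᵘ-homo‿- (ι p) ⟨
    toℚᵘ (- ι p)       ∎)
    where open ℚᵘ.≤-Reasoning

  ι-pos-+ : ∀ m n → ι (+ (m ℕ.+ n)) ≡ ι (+ m) + ι (+ n)
  ι-pos-+ m n = trans (cong ι (pos-+ m n)) (ι-+ (+ m) (+ n))

  ι-pos-* : ∀ m n → ι (+ (m ℕ.* n)) ≡ ι (+ m) * ι (+ n)
  ι-pos-* m n = trans (cong ι (pos-* m n)) (ι-* (+ m) (+ n))

  ι-pos-*+* : ∀ a b c d → ι (+ (a ℕ.* b ℕ.+ c ℕ.* d)) ≡ ι (+ a) * ι (+ b) + ι (+ c) * ι (+ d)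
  ι-pos-*+* a b c d = trans (ι-pos-+ (a ℕ.* b) (c ℕ.* d)) (cong₂ _+_ (ι-pos-* a b) (ι-pos-* c d))

  ι-pos-*+*-cong : ∀ a b c d a′ b′ c′ d′ → a ℕ.* b ℕ.+ c ℕ.* d ≡ a′ ℕ.* b′ ℕ.+ c′ ℕ.* d′ →
    ι (+ a) * ι (+ b) + ι (+ c) * ι (+ d) ≡ ι (+ a′) * ι (+ b′) + ι (+ c′) * ι (+ d′)
  ι-pos-*+*-cong a b c d a′ b′ c′ d′ eq =
    trans (sym (ι-pos-*+* a b c d)) (trans (cong (λ w → ι (+ w)) eq) (ι-pos-*+* a′ b′ c′ d′))

  p/q*q≡p : ∀ p q .{{_ : ℕ.NonZero q}} → (p / q) * ι (+ q) ≡ ι p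
  p/q*q≡p p (suc q) = toℚᵘ-injective (begin-equality
    toℚᵘ ((p / suc q) * ι (+ suc q))          ≃⟨ toℚᵘ-homo-* (p / suc q) (ι (+ suc q)) ⟩
    toℚᵘ (p / suc q) ℚᵘ.* toℚᵘ (ι (+ suc q))  ≃⟨ ℚᵘ.*-cong (toℚᵘ-fromℚᵘ (mkℚᵘ p q)) (toℚᵘ-ι (+ suc q)) ⟩
    mkℚᵘ p q ℚᵘ.* mkℚᵘ (+ suc q) 0            ≃⟨ *≡* (cross p (+ suc q)) ⟩
    mkℚᵘ p 0                                  ≃⟨ toℚᵘ-ι p ⟨
    toℚᵘ (ι p)                                ∎)
    where
    open ℚᵘ.≤-Reasoning
    cross : ∀ p q → (p ℤ.* q) ℤ.* + 1 ≡ p ℤ.* (q ℤ.* + 1)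
    cross = solve-∀

  *-cancelʳ-ι : ∀ q .{{_ : ℕ.NonZero q}} {x y} → x * ι (+ q) ≡ y * ι (+ q) → x ≡ y
  *-cancelʳ-ι q {x} {y} xq≡yq = begin
    x                              ≡⟨ *-identityʳ x ⟨
    x * 1ℚ                         ≡⟨ cong (x *_) q*1/q≡1 ⟨
    x * (ι (+ q) * (+ 1 / q))      ≡⟨ *-assoc x _ _ ⟨
    x * ι (+ q) * (+ 1 / q)        ≡⟨ cong (_* (+ 1 / q)) xq≡yq ⟩
    y * ι (+ q) * (+ 1 / q)        ≡⟨ *-assoc y _ _ ⟩
    y * (ι (+ q) * (+ 1 / q))      ≡⟨ cong (y *_) q*1/q≡1 ⟩
    y * 1ℚ                         ≡⟨ *-identityʳ y ⟩
    y                              ∎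
    where
    open ≡-Reasoning
    q*1/q≡1 : ι (+ q) * (+ 1 / q) ≡ 1ℚ
    q*1/q≡1 = trans (*-comm (ι (+ q)) (+ 1 / q)) (p/q*q≡p (+ 1) q)

module Cassini where
  open import Defs using (fib)
  open import Data.Nat using (zero; suc)
  open import Data.Integer using (+_; -[1+_]; _+_; _-_; _*_; _^_)
  open import Data.Integer.Properties using (pos-+)
  open import Data.Integer.Tactic.RingSolver using (solve-∀)
  import Data.Rational as ℚ
  open import Relation.Binary.PropositionalEquality
  open ≡-Reasoning
  open RationalCasts using (ι; ι-+; ι-*)

  cassini : ∀ m → + fib m * + fib (suc (suc m)) ≡ + fib (suc m) * + fib (suc m) + -[1+ 0 ] ^ suc m
  cassini zero = refl
  cassini (suc m) = begin
    b * + fib (suc (suc (suc m)))                     ≡⟨ cong (b *_) (trans (pos-+ (fib (suc (suc m))) (fib (suc m))) (cong (_+ b) F₂)) ⟩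
    b * ((b + a) + b)                                 ≡⟨ expand a b ⟩
    (b + a) * (b + a) + (b * b - a * (b + a))         ≡⟨ cong (λ w → (b + a) * (b + a) + (b * b - w)) previous ⟩
    (b + a) * (b + a) + (b * b - (b * b + σ))         ≡⟨ cancel ((b + a) * (b + a)) (b * b) σ ⟩
    (b + a) * (b + a) + -[1+ 0 ] * σ                  ≡⟨ cong (λ w → w * w + -[1+ 0 ] * σ) F₂ ⟨
    + fib (suc (suc m)) * + fib (suc (suc m)) + -[1+ 0 ] ^ suc (suc m) ∎
    where
    a = + fib m
    b = + fib (suc m)
    σ = -[1+ 0 ] ^ suc m
    F₂ : + fib (suc (suc m)) ≡ b + a
    F₂ = pos-+ (fib (suc m)) (fib m)
    previous : a * (b + a) ≡ b * b + σ
    previous = trans (cong (a *_) (sym F₂)) (cassini m)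
    expand : ∀ a b → b * ((b + a) + b) ≡ (b + a) * (b + a) + (b * b - a * (b + a))
    expand = solve-∀
    cancel : ∀ x y σ → x + (y - (y + σ)) ≡ x + -[1+ 0 ] * σ
    cancel = solve-∀

  cassiniℚ : ∀ m → ι (+ fib m) ℚ.* ι (+ fib (suc (suc m))) ≡ ι (+ fib (suc m)) ℚ.* ι (+ fib (suc m)) ℚ.+ ι (-[1+ 0 ] ^ suc m)
  cassiniℚ m = begin
    ι (+ fib m) ℚ.* ι (+ fib (suc (suc m)))                     ≡⟨ ι-* (+ fib m) _ ⟨
    ι (+ fib m * + fib (suc (suc m)))                           ≡⟨ cong ι (cassini m) ⟩
    ι (+ fib (suc m) * + fib (suc m) + σ)                       ≡⟨ ι-+ (+ fib (suc m) * + fib (suc m)) σ ⟩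
    ι (+ fib (suc m) * + fib (suc m)) ℚ.+ ι σ                   ≡⟨ cong (ℚ._+ ι σ) (ι-* (+ fib (suc m)) _) ⟩
    ι (+ fib (suc m)) ℚ.* ι (+ fib (suc m)) ℚ.+ ι σ             ∎
    where σ = -[1+ 0 ] ^ suc m

module Deconvolution where
  open import Defs using (sumℚFrom1)
  open import Data.Nat as ℕ using (ℕ; zero; suc; _∸_; _≤_; s≤s; z≤n)
  open import Data.Nat.Properties using (m≤n⇒m≤1+n; ≤-refl; n≤1+n; ≤-trans)
  open import Data.Integer using (+_)
  open import Data.Rational using (ℚ; _*_; _+_; -_; _-_; 0ℚ)
  open import Data.Rational.Properties using (*-distribʳ-+; +-identityʳ; *-zeroʳ)
  open import Data.Rational.Solver using (module +-*-Solver)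
  open +-*-Solver
  open import Relation.Binary.PropositionalEquality
  open ≡-Reasoning
  open RationalCasts using (ι; *-cancelʳ-ι)

  sumℚFrom1-cong : ∀ m {f g : ℕ → ℚ} → (∀ k → 1 ≤ k → k ≤ m → f k ≡ g k) → sumℚFrom1 m f ≡ sumℚFrom1 m g
  sumℚFrom1-cong zero f≗g = refl
  sumℚFrom1-cong (suc m) f≗g =
    cong₂ _+_ (sumℚFrom1-cong m (λ k 1≤k k≤m → f≗g k 1≤k (m≤n⇒m≤1+n k≤m))) (f≗g (suc m) (s≤s z≤n) ≤-refl)

  sumℚFrom1-suc : ∀ m (f : ℕ → ℚ) → sumℚFrom1 (suc m) f ≡ f 1 + sumℚFrom1 m (λ k → f (suc k))
  sumℚFrom1-suc zero f = solve 1 (λ x → con 0ℚ :+ x := x :+ con 0ℚ) refl (f 1)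
  sumℚFrom1-suc (suc m) f rewrite sumℚFrom1-suc m f =
    solve 3 (λ x y z → (x :+ y) :+ z := x :+ (y :+ z)) refl (f 1) _ _

  sumℚFrom1-*ʳ : ∀ m (f : ℕ → ℚ) x → sumℚFrom1 m (λ k → f k * x) ≡ sumℚFrom1 m f * x
  sumℚFrom1-*ʳ zero f x = solve 1 (λ x → con 0ℚ := con 0ℚ :* x) refl x
  sumℚFrom1-*ʳ (suc m) f x rewrite sumℚFrom1-*ʳ m f x = sym (*-distribʳ-+ x (sumℚFrom1 m f) (f (suc m)))

  module _ (N d : ℕ) .{{_ : ℕ.NonZero d}} (C C′ σ : ℚ) (t u s : ℕ → ℚ)
    (recurrence : ∀ j → 1 ≤ j → j ≤ N → ι (+ d) * u j + C * u (j ∸ 1) ≡ C * s j + C′ * s (j ∸ 1))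
    (u₀≡0 : u 0 ≡ 0ℚ) (s₀≡0 : s 0 ≡ 0ℚ)
    (cassini : ι (+ d) * C′ ≡ C * C + σ)
    (t₁ : t 1 * ι (+ d) ≡ - σ)
    (t-suc : ∀ k → 1 ≤ k → t (suc k) * ι (+ d) ≡ - (C * t k)) where

    private
      D = ι (+ d)

    convolution : ℕ → ℚ
    convolution j = sumℚFrom1 (j ∸ 1) (λ k → t k * s (j ∸ k))

    convolution-suc : ∀ j → convolution (suc (suc j)) * D ≡ - σ * s (suc j) + convolution (suc j) * - C
    convolution-suc j = begin
      convolution (suc (suc j)) * D
        ≡⟨ cong (_* D) (sumℚFrom1-suc j (λ k → t k * s (suc (suc j) ∸ k))) ⟩
      (t 1 * s (suc j) + sumℚFrom1 j (λ k → t (suc k) * s (suc j ∸ k))) * D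
        ≡⟨ *-distribʳ-+ D (t 1 * s (suc j)) _ ⟩
      t 1 * s (suc j) * D + sumℚFrom1 j (λ k → t (suc k) * s (suc j ∸ k)) * D
        ≡⟨ cong₂ _+_ (trans (swap (t 1) (s (suc j)) D) (cong (_* s (suc j)) t₁))
                     (sym (sumℚFrom1-*ʳ j (λ k → t (suc k) * s (suc j ∸ k)) D)) ⟩
      - σ * s (suc j) + sumℚFrom1 j (λ k → t (suc k) * s (suc j ∸ k) * D)
        ≡⟨ cong (λ w → - σ * s (suc j) + w) (sumℚFrom1-cong j (λ k 1≤k _ →
             trans (swap (t (suc k)) (s (suc j ∸ k)) D)
                   (trans (cong (_* s (suc j ∸ k)) (t-suc k 1≤k)) (neg-swap C (t k) (s (suc j ∸ k)))))) ⟩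
      - σ * s (suc j) + sumℚFrom1 j (λ k → t k * s (suc j ∸ k) * - C)
        ≡⟨ cong (λ w → - σ * s (suc j) + w) (sumℚFrom1-*ʳ j (λ k → t k * s (suc j ∸ k)) (- C)) ⟩
      - σ * s (suc j) + convolution (suc j) * - C ∎
      where
      swap : ∀ a b c → a * b * c ≡ a * c * b
      swap = solve 3 (λ a b c → a :* b :* c := a :* c :* b) refl
      neg-swap : ∀ c a b → - (c * a) * b ≡ a * b * - c
      neg-swap = solve 3 (λ c a b → :- (c :* a) :* b := a :* b :* :- c) refl

    solution-suc : ∀ j → suc (suc j) ≤ N → D * u (suc j) ≡ C * s (suc j) - convolution (suc j) →
      D * u (suc (suc j)) ≡ C * s (suc (suc j)) - convolution (suc (suc j))
    solution-suc j j+2≤N previous = *-cancelʳ-ι d (begin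
      D * u₂ * D                                              ≡⟨ expand D u₂ C u₁ ⟩
      (D * u₂ + C * u₁) * D - C * (D * u₁)                    ≡⟨ cong₂ (λ w v → w * D - C * v) recurrence₂ previous ⟩
      (C * s₂ + C′ * s₁) * D - C * (C * s₁ - E₁)              ≡⟨ regroup C C′ D s₂ s₁ E₁ ⟩
      C * s₂ * D + D * C′ * s₁ - C * C * s₁ + C * E₁          ≡⟨ cong (λ w → C * s₂ * D + w * s₁ - C * C * s₁ + C * E₁) cassini ⟩
      C * s₂ * D + (C * C + σ) * s₁ - C * C * s₁ + C * E₁     ≡⟨ collect C σ D s₂ s₁ E₁ ⟩
      C * s₂ * D - (- σ * s₁ + E₁ * - C)                      ≡⟨ cong (λ w → C * s₂ * D - w) (convolution-suc j) ⟨
      C * s₂ * D - convolution (suc (suc j)) * D              ≡⟨ factor C s₂ D (convolution (suc (suc j))) ⟩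
      (C * s₂ - convolution (suc (suc j))) * D                ∎)
      where
      u₂ = u (suc (suc j)) ; u₁ = u (suc j) ; s₂ = s (suc (suc j)) ; s₁ = s (suc j) ; E₁ = convolution (suc j)
      recurrence₂ = recurrence (suc (suc j)) (s≤s z≤n) j+2≤N
      expand : ∀ D u₂ C u₁ → D * u₂ * D ≡ (D * u₂ + C * u₁) * D - C * (D * u₁)
      expand = solve 4 (λ D u₂ C u₁ → D :* u₂ :* D := (D :* u₂ :+ C :* u₁) :* D :- C :* (D :* u₁)) refl
      regroup : ∀ C C′ D s₂ s₁ E₁ →
        (C * s₂ + C′ * s₁) * D - C * (C * s₁ - E₁) ≡ C * s₂ * D + D * C′ * s₁ - C * C * s₁ + C * E₁
      regroup = solve 6 (λ C C′ D s₂ s₁ E₁ → (C :* s₂ :+ C′ :* s₁) :* D :- C :* (C :* s₁ :- E₁)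
                                            := C :* s₂ :* D :+ D :* C′ :* s₁ :- C :* C :* s₁ :+ C :* E₁) refl
      collect : ∀ C σ D s₂ s₁ E₁ →
        C * s₂ * D + (C * C + σ) * s₁ - C * C * s₁ + C * E₁ ≡ C * s₂ * D - (- σ * s₁ + E₁ * - C)
      collect = solve 6 (λ C σ D s₂ s₁ E₁ → C :* s₂ :* D :+ (C :* C :+ σ) :* s₁ :- C :* C :* s₁ :+ C :* E₁
                                            := C :* s₂ :* D :- (:- σ :* s₁ :+ E₁ :* :- C)) refl
      factor : ∀ C s₂ D E₂ → C * s₂ * D - E₂ * D ≡ (C * s₂ - E₂) * D
      factor = solve 4 (λ C s₂ D E₂ → C :* s₂ :* D :- E₂ :* D := (C :* s₂ :- E₂) :* D) refl

    solution : ∀ j → 1 ≤ j → j ≤ N → D * u j ≡ C * s j - convolution j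
    solution (suc zero) _ 1≤N = begin
      D * u 1              ≡⟨ +-identityʳ (D * u 1) ⟨
      D * u 1 + 0ℚ         ≡⟨ cong (λ w → D * u 1 + w) (trans (cong (C *_) u₀≡0) (*-zeroʳ C)) ⟨
      D * u 1 + C * u 0    ≡⟨ recurrence 1 (s≤s z≤n) 1≤N ⟩
      C * s 1 + C′ * s 0   ≡⟨ cong (λ w → C * s 1 + w) (trans (cong (C′ *_) s₀≡0) (*-zeroʳ C′)) ⟩
      C * s 1 - 0ℚ         ∎
    solution (suc (suc j)) _ j+2≤N =
      solution-suc j j+2≤N (solution (suc j) (s≤s z≤n) (≤-trans (n≤1+n (suc j)) j+2≤N))

module AlternatingTerm where
  open import Data.Nat as ℕ using (ℕ; suc; _+_; _^_; _∸_; _≤_)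
  open import Data.Nat.Properties using (m^n≢0; *-identityʳ)
  open import Data.Integer as ℤ using (ℤ; +_; -[1+_]) renaming (_^_ to _^ℤ_; _*_ to _*ℤ_)
  open import Data.Integer.Properties using (pos-*)
  open import Data.Integer.Tactic.RingSolver using (solve-∀)
  open import Data.Rational using (ℚ; _/_; _*_; -_)
  open import Data.Rational.Properties using (*-assoc; neg-distribˡ-*)
  open import Relation.Binary.PropositionalEquality
  open ≡-Reasoning
  open RationalCasts using (ι; ι-*; ι-neg; ι-pos-*; p/q*q≡p; *-cancelʳ-ι)

  module _ (e c d : ℕ) .{{_ : ℕ.NonZero d}} where

    numerator : ℕ → ℤ
    numerator k = (-[1+ 0 ] ^ℤ (k + e)) *ℤ + (c ^ (k ∸ 1))

    term : ℕ → ℚ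
    term k = (numerator k / (d ^ k)) {{m^n≢0 d k}}

    term*denominator : ∀ k → term k * ι (+ (d ^ k)) ≡ ι (numerator k)
    term*denominator k = p/q*q≡p (numerator k) (d ^ k) {{m^n≢0 d k}}

    term-one : term 1 * ι (+ d) ≡ - ι (-[1+ 0 ] ^ℤ e)
    term-one = begin
      term 1 * ι (+ d)            ≡⟨ cong (λ w → term 1 * ι (+ w)) (*-identityʳ d) ⟨
      term 1 * ι (+ (d ^ 1))      ≡⟨ term*denominator 1 ⟩
      ι (numerator 1)             ≡⟨ cong ι (sign (-[1+ 0 ] ^ℤ e)) ⟩
      ι (ℤ.- (-[1+ 0 ] ^ℤ e))     ≡⟨ ι-neg (-[1+ 0 ] ^ℤ e) ⟩
      - ι (-[1+ 0 ] ^ℤ e)         ∎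
      where
      sign : ∀ x → ((ℤ.- + 1) *ℤ x) *ℤ + 1 ≡ ℤ.- x
      sign = solve-∀

    term-suc : ∀ k → 1 ≤ k → term (suc k) * ι (+ d) ≡ - (ι (+ c) * term k)
    term-suc k@(suc k′) _ = *-cancelʳ-ι (d ^ k) {{m^n≢0 d k}} (begin
      term (suc k) * ι (+ d) * ι (+ (d ^ k))      ≡⟨ *-assoc (term (suc k)) _ _ ⟩
      term (suc k) * (ι (+ d) * ι (+ (d ^ k)))    ≡⟨ cong (term (suc k) *_) (ι-pos-* d (d ^ k)) ⟨
      term (suc k) * ι (+ (d ^ suc k))            ≡⟨ term*denominator (suc k) ⟩
      ι (numerator (suc k))                       ≡⟨ cong (λ w → ι ((-[1+ 0 ] ^ℤ (suc k + e)) *ℤ w)) (pos-* c (c ^ k′)) ⟩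
      ι ((-[1+ 0 ] ^ℤ (suc k + e)) *ℤ (+ c *ℤ + (c ^ k′)))  ≡⟨ cong ι (sign (-[1+ 0 ] ^ℤ (k + e)) (+ c) (+ (c ^ k′))) ⟩
      ι (ℤ.- (+ c *ℤ numerator k))                ≡⟨ trans (ι-neg (+ c *ℤ numerator k)) (cong -_ (ι-* (+ c) (numerator k))) ⟩
      - (ι (+ c) * ι (numerator k))               ≡⟨ cong (λ w → - (ι (+ c) * w)) (term*denominator k) ⟨
      - (ι (+ c) * (term k * ι (+ (d ^ k))))      ≡⟨ cong -_ (*-assoc (ι (+ c)) _ _) ⟨
      - (ι (+ c) * term k * ι (+ (d ^ k)))        ≡⟨ neg-distribˡ-* (ι (+ c) * term k) _ ⟩
      - (ι (+ c) * term k) * ι (+ (d ^ k))        ∎)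
      where
      sign : ∀ x c y → ((ℤ.- + 1) *ℤ x) *ℤ (c *ℤ y) ≡ ℤ.- (c *ℤ (x *ℤ y))
      sign = solve-∀

open import Defs
open import Data.Nat using (ℕ; _+_; _∸_; _≤_; _^_)
open import Data.Nat.Properties using (m^n≢0)
open import Data.Integer using (+_; -[1+_]) renaming (_^_ to _^ℤ_; _*_ to _*ℤ_)
open import Data.Rational using (ℚ; _/_; _*_; _-_)
open import Relation.Binary.PropositionalEquality using (_≡_)
open import Data.Nat using (suc; s≤s; z≤n; >-nonZero)
open import Data.Nat.Properties using (+-comm; ≤-trans; m≤pred[n]⇒suc[m]≤n)
open import Data.Rational using () renaming (_+_ to _+ℚ_)
open import Relation.Binary.PropositionalEquality using (cong)
open import Function using (_∘_)
open BinomialRows using (module Linked; pow-rows-linked; pow-zeroColumn)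
open RationalCasts using (ι; ι-pos-*+*-cong)
open Cassini using (cassiniℚ)
open AlternatingTerm using (term; term-one; term-suc)
open Deconvolution using (solution)

proposition5 : (n e : ℕ) → 2 ≤ n → (he : 2 ≤ e) → (i j : ℕ) → 1 ≤ i → i ≤ n ∸ 1 → 1 ≤ j → j ≤ n →
    (+ fib (e ∸ 1) / 1) * (+ a n e (i + 1) j / 1)
      ≡ (+ fib e / 1) * (+ a n e i j / 1)
        - sumℚFrom1 (j ∸ 1) (λ k →
            ((((-[1+ 0 ]) ^ℤ (k + e)) *ℤ (+ (fib e ^ (k ∸ 1))))
               / (fib (e ∸ 1) ^ k)) {{m^n≢0 (fib (e ∸ 1)) k {{fib-pred-nonzero e he}}}}
            * (+ a n e i (j ∸ k) / 1))
proposition5 n e@(suc (suc m)) 2≤n (s≤s (s≤s z≤n)) i j 1≤i i≤n∸1 1≤j j≤n rewrite +-comm i 1 =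
  solution n d (ι (+ fib e)) (ι (+ fib (suc e))) (ι (-[1+ 0 ] ^ℤ e)) (term e (fib e) d) (cast z) (cast x)
    recurrence (cong (ι ∘ +_) (pow-zeroColumn n e (suc i) (s≤s z≤n))) (cong (ι ∘ +_) (pow-zeroColumn n e i 1≤i))
    (cassiniℚ (suc m)) (term-one e (fib e) d) (term-suc e (fib e) d)
    j 1≤j j≤n
  where
  d = fib (suc m)
  instance
    d≢0 = fib-suc-nonzero m
  i<n = m≤pred[n]⇒suc[m]≤n {{>-nonZero (≤-trans (s≤s z≤n) 2≤n)}} i≤n∸1
  z x : ℕ → ℕ
  z = a n e (suc i)
  x = a n e i
  cast : (ℕ → ℕ) → ℕ → ℚ
  cast w k = ι (+ w k)
  recurrence : ∀ k → 1 ≤ k → k ≤ n →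
    ι (+ d) * cast z k +ℚ ι (+ fib e) * cast z (k ∸ 1) ≡ ι (+ fib e) * cast x k +ℚ ι (+ fib (suc e)) * cast x (k ∸ 1)
  recurrence k 1≤k k≤n = ι-pos-*+*-cong d (z k) (fib e) (z (k ∸ 1)) (fib e) (x k) (fib (suc e)) (x (k ∸ 1))
    (Linked.interior (pow-rows-linked n e i 1≤i i<n) k 1≤k k≤n)
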